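{- Let $t\ge 2$ and let $H_t$ be the graph obtained from $t$ disjoint copies of the grid graph $P_4\,\square\,P_3$ and one extra vertex $x$ by joining $x$ by an edge to the vertex $(2,3)$ of each copy. Then $\mu_{\rm d}(H_t)=5t$ and $\mu_{\rm o}(H_t)=4t$.
   Context: The grid graph $P_4\,\square\,P_3$ has vertex set $[4]\times[3]$, with $(i,j)$ adjacent to $(k,\ell)$ iff $|i-k|+|j-\ell|=1$. For a graph $G$ and $X\subseteq V(G)$, vertices $u,v\in V(G)$ are $X$-visible if there exists a shortest $u,v$-path $P$ with $V(P)\cap X\subseteq\{u,v\}$. $X$ is an outer mutual-visibility set if every two vertices of $X$ are $X$-visible and every $u\in X$, $v\in V(G)\setminus X$ are $X$-visible; a dual mutual-visibility set if every two vertices of $X$ are $X$-visible and every two vertices of $V(G)\setminus X$ are $X$-visible. $\mu_{\rm o}(G)$ and $\mu_{\rm d}(G)$ are the maximum cardinalities of an outer, respectively dual, mutual-visibility set of $G$. -}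

module Defs where

open import Data.Nat using (ℕ; zero; suc; _+_; _*_; _≤_; ∣_-_∣)
open import Data.Fin using (Fin; toℕ)
open import Data.Bool using (Bool; true; false; if_then_else_)
open import Data.List using (List; []; _∷_; map; concatMap)
open import Data.Nat.ListAction using (sum)
open import Data.List.Relation.Unary.All using (All)
open import Data.List using (allFin)
open import Data.Product using (Σ; _×_)
open import Data.Sum using (_⊎_)
open import Data.Empty using (⊥)
open import Relation.Binary.PropositionalEquality using (_≡_)

module _ {V : Set} (E : V → V → Set) where

  data Walk : V → V → Set where
    nil  : ∀ {u} → Walk u u
    cons : ∀ {u w v} → E u w → Walk w v → Walk u v

  len : ∀ {u v} → Walk u v → ℕ
  len nil        = 0
  len (cons _ p) = suc (len p)

  verts : ∀ {u v} → Walk u v → List V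
  verts {u} nil        = u ∷ []
  verts {u} (cons _ p) = u ∷ verts p

  -- a shortest u,v-walk (which is necessarily a path)
  IsShortest : ∀ {u v} → Walk u v → Set
  IsShortest {u} {v} p = (q : Walk u v) → len p ≤ len q

  Visible : (V → Bool) → V → V → Set
  Visible X u v =
    Σ (Walk u v) λ p → IsShortest p ×
      All (λ w → X w ≡ true → (w ≡ u) ⊎ (w ≡ v)) (verts p)

  IsOuterMV : (V → Bool) → Set
  IsOuterMV X =
    (∀ u v → X u ≡ true → X v ≡ true  → Visible X u v) ×
    (∀ u v → X u ≡ true → X v ≡ false → Visible X u v)

  IsDualMV : (V → Bool) → Set
  IsDualMV X =
    (∀ u v → X u ≡ true  → X v ≡ true  → Visible X u v) ×
    (∀ u v → X u ≡ false → X v ≡ false → Visible X u v)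

card : {V : Set} → List V → (V → Bool) → ℕ
card vs X = sum (map (λ v → if X v then 1 else 0) vs)

IsMaxCard : {V : Set} → List V → ((V → Bool) → Set) → ℕ → Set
IsMaxCard vs P k =
  (Σ (_ → Bool) λ X → P X × card vs X ≡ k) ×
  (∀ X → P X → card vs X ≤ k)

-- The graph H_t.  Copy c of P₄ □ P₃ has vertices cp c i j with
-- i : Fin 4, j : Fin 3 (0-based: grid vertex (i+1, j+1)).
-- hub is the extra vertex x.

data HV (t : ℕ) : Set where
  hub : HV t
  cp  : Fin t → Fin 4 → Fin 3 → HV t

-- the grid vertex (2,3), i.e. 0-based (1,2)
IsAttach : Fin 4 → Fin 3 → Set
IsAttach i j = (toℕ i ≡ 1) × (toℕ j ≡ 2)

HE : (t : ℕ) → HV t → HV t → Set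
HE t hub       hub          = ⊥
HE t hub       (cp c i j)   = IsAttach i j
HE t (cp c i j) hub         = IsAttach i j
HE t (cp c i j) (cp c′ k l) =
  (c ≡ c′) × (∣ toℕ i - toℕ k ∣ + ∣ toℕ j - toℕ l ∣ ≡ 1)

-- enumeration of V(H_t), each vertex exactly once
allHV : (t : ℕ) → List (HV t)
allHV t = hub ∷ concatMap (λ c → concatMap (λ i → map (λ j → cp c i j)
            (allFin 3)) (allFin 4)) (allFin t)

-- Inside a copy of the grid, H_t induces the grid metric, and every shortest path between
-- two copies runs through x and the attachment vertices (2,3). Hence visibility of two vertices
-- of one copy, or of a vertex and x, depends only on how X meets that copy, and amounts to the
-- existence of a monotone grid path avoiding X. If x ∈ X, no two vertices of different copies
-- are X-visible: for a dual set this forces one copy to have all its vertices of one status and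
-- another copy the opposite status, so some copy lies inside X, which is impossible; for an outer
-- set it forces every copy to avoid X. If x ∉ X, the trace of X on each copy satisfies a list of
-- visibility requirements, and an exhaustive search over the 2¹² subsets of the grid shows that
-- such a trace has at most 5 (dual) resp. 4 (outer) cells. Conversely, the same 5-cell resp.
-- 4-cell pattern placed in every copy is a dual resp. outer mutual-visibility set.

module Submission where

open import Data.Bool using (Bool; true; false; T; not; _∧_; _∨_; if_then_else_)
import Data.Bool as Bool
open import Data.Bool.ListAction using (any; all)
open import Data.Bool.Properties using (T?; T-∧; T-∨; T-≡; T-not-≡; ¬-not)
open import Data.Fin using (Fin; toℕ; #_; combine; remQuot)
import Data.Fin as Fin
open import Data.Fin.Properties using (toℕ-injective; remQuot-combine; punchInᵢ≢i)
open import Data.Fin.Subset using (Subset; ∣_∣)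
open import Data.Fin.Subset.Properties using (anySubset?; ∣⊥∣≡0)
open import Data.List using (List; []; _∷_; _++_; allFin; cartesianProduct; map; concatMap; length)
open import Data.List.Membership.Propositional using (_∈_; lose)
open import Data.List.Membership.Propositional.Properties using (∈-allFin; ∈-cartesianProduct⁺)
open import Data.List.Properties using (map-++; map-cong; length-tabulate)
open import Data.List.Relation.Unary.All as All using (All; []; _∷_)
open import Data.List.Relation.Unary.All.Properties using (all⁺; all⁻)
open import Data.List.Relation.Unary.Any using (here; there; satisfied)
open import Data.List.Relation.Unary.Any.Properties using (any⁺; any⁻)
open import Data.Nat using (ℕ; zero; suc; _+_; _*_; _≤_; _<?_; _≡ᵇ_; ∣_-_∣; z≤n; s≤s)
open import Data.Nat.ListAction using (sum)
open import Data.Nat.ListAction.Properties using (sum-++)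
open import Data.Nat.Properties
open import Algebra.Properties.CommutativeSemigroup +-commutativeSemigroup using (interchange)
open import Data.Product using (Σ; ∃; _×_; _,_; proj₁; proj₂)
open import Data.Product.Properties using (≡-dec)
open import Data.Sum using (_⊎_; inj₁; inj₂; swap)
open import Data.Vec using (lookup; tabulate; []; _∷_)
import Data.Vec as Vec
open import Data.Vec.Properties using (lookup∘tabulate; tabulate-cong)
open import Function using (_∘_; id)
open import Function.Bundles using (Equivalence)
open import Relation.Binary.Definitions using (DecidableEquality)
open import Relation.Binary.PropositionalEquality
open import Relation.Nullary using (¬_; yes; no; does; contradiction)
open import Relation.Nullary.Decidable
  using (⌊_⌋; dec-true; dec-false; toWitness; fromWitness; False; toWitnessFalse; _×-dec_)

open import Defs

module _ {V : Set} {E : V → V → Set} where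

  infixr 5 _++ʷ_

  _++ʷ_ : ∀ {u v w} → Walk E u v → Walk E v w → Walk E u w
  nil      ++ʷ q = q
  cons e p ++ʷ q = cons e (p ++ʷ q)

  len-++ʷ : ∀ {u v w} (p : Walk E u v) (q : Walk E v w) → len E (p ++ʷ q) ≡ len E p + len E q
  len-++ʷ nil        q = refl
  len-++ʷ (cons e p) q = cong suc (len-++ʷ p q)

  head-∈-verts : ∀ {u v} (p : Walk E u v) → u ∈ verts E p
  head-∈-verts nil        = here refl
  head-∈-verts (cons _ _) = here refl

  module _ {P : V → Set} where

    All-verts-last : ∀ {u v} (p : Walk E u v) → All P (verts E p) → P v
    All-verts-last nil        (Pv ∷ _)  = Pv
    All-verts-last (cons _ p) (_ ∷ Pp) = All-verts-last p Pp

    All-verts-++ʷ : ∀ {u v w} (p : Walk E u v) (q : Walk E v w) →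
                    All P (verts E p) → All P (verts E q) → All P (verts E (p ++ʷ q))
    All-verts-++ʷ nil        q _          Pq = Pq
    All-verts-++ʷ (cons e p) q (Pu ∷ Pp) Pq = Pu ∷ All-verts-++ʷ p q Pp Pq

    All-verts-++ʷ⁻ˡ : ∀ {u v w} (p : Walk E u v) (q : Walk E v w) →
                      All P (verts E (p ++ʷ q)) → All P (verts E p)
    All-verts-++ʷ⁻ˡ nil        q Pq        = All.lookup Pq (head-∈-verts q) ∷ []
    All-verts-++ʷ⁻ˡ (cons e p) q (Pu ∷ Ppq) = Pu ∷ All-verts-++ʷ⁻ˡ p q Ppq

  unsnoc : ∀ {u w v} (e : E u w) (p : Walk E w v) →
           ∃ λ x → Σ (Walk E u x) λ q → Σ (E x v) λ e′ → cons e p ≡ q ++ʷ cons e′ nil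
  unsnoc e nil = _ , nil , e , refl
  unsnoc e (cons e′ p) with unsnoc e′ p
  ... | x , q , e″ , eq = x , cons e q , e″ , cong (cons e) eq

  InteriorAvoids : (V → Bool) → ∀ {u v} → Walk E u v → Set
  InteriorAvoids X {u} {v} p = All (λ w → X w ≡ true → w ≡ u ⊎ w ≡ v) (verts E p)

  InteriorAvoids-cons : ∀ {X u w v} (e : E u w) (p : Walk E w v) →
                        (X w ≡ true → w ≡ v) → InteriorAvoids X p → InteriorAvoids X (cons e p)
  InteriorAvoids-cons {X} e p w∈X⇒w≡v avoids = (λ _ → inj₁ refl) ∷ All.map shift avoids
    where
    shift : ∀ {x} → (X x ≡ true → x ≡ _ ⊎ x ≡ _) → X x ≡ true → x ≡ _ ⊎ x ≡ _
    shift h x∈X with h x∈X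
    ... | inj₁ refl = inj₂ (w∈X⇒w≡v x∈X)
    ... | inj₂ x≡v  = inj₂ x≡v

  InteriorAvoids-++ʷ : ∀ {X u w v} (p : Walk E u w) (q : Walk E w v) → X w ≡ false →
                       InteriorAvoids X p → InteriorAvoids X q → InteriorAvoids X (p ++ʷ q)
  InteriorAvoids-++ʷ {X} p q w∉X avoidsP avoidsQ =
    All-verts-++ʷ p q (All.map fromLeft avoidsP) (All.map fromRight avoidsQ)
    where
    fromLeft : ∀ {x} → (X x ≡ true → x ≡ _ ⊎ x ≡ _) → X x ≡ true → x ≡ _ ⊎ x ≡ _
    fromLeft h x∈X with h x∈X
    ... | inj₁ x≡u    = inj₁ x≡u
    ... | inj₂ refl   = contradiction (trans (sym x∈X) w∉X) λ ()
    fromRight : ∀ {x} → (X x ≡ true → x ≡ _ ⊎ x ≡ _) → X x ≡ true → x ≡ _ ⊎ x ≡ _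
    fromRight h x∈X with h x∈X
    ... | inj₁ refl   = contradiction (trans (sym x∈X) w∉X) λ ()
    ... | inj₂ x≡v    = inj₂ x≡v

  module _ (E-sym : ∀ {u v} → E u v → E v u) where

    infixr 5 _ʳ++ʷ_

    _ʳ++ʷ_ : ∀ {u v w} → Walk E u v → Walk E u w → Walk E v w
    nil      ʳ++ʷ q = q
    cons e p ʳ++ʷ q = p ʳ++ʷ cons (E-sym e) q

    reverseʷ : ∀ {u v} → Walk E u v → Walk E v u
    reverseʷ p = p ʳ++ʷ nil

    len-ʳ++ʷ : ∀ {u v w} (p : Walk E u v) (q : Walk E u w) → len E (p ʳ++ʷ q) ≡ len E p + len E q
    len-ʳ++ʷ nil        q = refl
    len-ʳ++ʷ (cons e p) q = trans (len-ʳ++ʷ p (cons (E-sym e) q)) (+-suc (len E p) (len E q))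

    len-reverseʷ : ∀ {u v} (p : Walk E u v) → len E (reverseʷ p) ≡ len E p
    len-reverseʷ p = trans (len-ʳ++ʷ p nil) (+-identityʳ (len E p))

    All-verts-ʳ++ʷ : ∀ {P : V → Set} {u v w} (p : Walk E u v) (q : Walk E u w) →
                     All P (verts E p) → All P (verts E q) → All P (verts E (p ʳ++ʷ q))
    All-verts-ʳ++ʷ nil        q _          Pq = Pq
    All-verts-ʳ++ʷ (cons e p) q (_ ∷ Pp) Pq =
      All-verts-ʳ++ʷ p (cons (E-sym e) q) Pp (All.lookup Pp (head-∈-verts p) ∷ Pq)

    isShortest-reverseʷ : ∀ {u v} (p : Walk E u v) → IsShortest E p → IsShortest E (reverseʷ p)
    isShortest-reverseʷ p shortest q = begin
      len E (reverseʷ p)  ≡⟨ len-reverseʷ p ⟩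
      len E p             ≤⟨ shortest (reverseʷ q) ⟩
      len E (reverseʷ q)  ≡⟨ len-reverseʷ q ⟩
      len E q             ∎
      where open ≤-Reasoning

    InteriorAvoids-reverseʷ : ∀ {X u v} (p : Walk E u v) → InteriorAvoids X p → InteriorAvoids X (reverseʷ p)
    InteriorAvoids-reverseʷ p avoids =
      All-verts-ʳ++ʷ p nil (All.map (λ h x∈X → swap (h x∈X)) avoids) ((λ _ → inj₂ refl) ∷ [])

    visible-sym : ∀ {X u v} → Visible E X u v → Visible E X v u
    visible-sym (p , shortest , avoids) =
      reverseʷ p , isShortest-reverseʷ p shortest , InteriorAvoids-reverseʷ p avoids

  visible-sameStatus : ∀ {X} → IsDualMV E X → ∀ {u v} → X u ≡ X v → Visible E X u v
  visible-sameStatus {X} (both-in , both-out) {u} {v} same with X u in u∈?X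
  ... | true  = both-in u v u∈?X (sym same)
  ... | false = both-out u v u∈?X (sym same)

  visible-fromMember : ∀ {X} → IsOuterMV E X → ∀ {u} v → X u ≡ true → Visible E X u v
  visible-fromMember {X} (in-in , in-out) {u} v u∈X with X v in v∈?X
  ... | true  = in-in u v u∈X v∈?X
  ... | false = in-out u v u∈X v∈?X

  module _ (d : V → V → ℕ) (d-refl : ∀ v → d v v ≡ 0)
           (d-edge : ∀ {u w} v → E u w → d u v ≤ suc (d w v)) where

    len-≥ : ∀ {u v} (p : Walk E u v) → d u v ≤ len E p
    len-≥ {u} nil        = ≤-reflexive (d-refl u)
    len-≥ {u} (cons e p) = ≤-trans (d-edge _ e) (s≤s (len-≥ p))

    isShortest : ∀ {u v} (p : Walk E u v) → len E p ≡ d u v → IsShortest E p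
    isShortest p p≡d q = ≤-trans (≤-reflexive p≡d) (len-≥ q)

Cell : Set
Cell = Fin 4 × Fin 3

cells : List Cell
cells = cartesianProduct (allFin 4) (allFin 3)

∈-cells : ∀ a → a ∈ cells
∈-cells (i , j) = ∈-cartesianProduct⁺ (∈-allFin i) (∈-allFin j)

infix 4 _≟ᶜ_
_≟ᶜ_ : DecidableEquality Cell
_≟ᶜ_ = ≡-dec Fin._≟_ Fin._≟_

manhattan : Cell → Cell → ℕ
manhattan (i , j) (k , l) = ∣ toℕ i - toℕ k ∣ + ∣ toℕ j - toℕ l ∣

manhattan-sym : ∀ a b → manhattan a b ≡ manhattan b a
manhattan-sym (i , j) (k , l) = cong₂ _+_ (∣-∣-comm (toℕ i) (toℕ k)) (∣-∣-comm (toℕ j) (toℕ l))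

manhattan-self : ∀ a → manhattan a a ≡ 0
manhattan-self (i , j) = cong₂ _+_ (∣n-n∣≡0 (toℕ i)) (∣n-n∣≡0 (toℕ j))

manhattan-triangle : ∀ a b c → manhattan a c ≤ manhattan a b + manhattan b c
manhattan-triangle (i , j) (p , q) (k , l) = begin
  ∣ toℕ i - toℕ k ∣ + ∣ toℕ j - toℕ l ∣
    ≤⟨ +-mono-≤ (∣-∣-triangle (toℕ i) (toℕ p) (toℕ k)) (∣-∣-triangle (toℕ j) (toℕ q) (toℕ l)) ⟩
  (∣ toℕ i - toℕ p ∣ + ∣ toℕ p - toℕ k ∣) + (∣ toℕ j - toℕ q ∣ + ∣ toℕ q - toℕ l ∣)
    ≡⟨ interchange ∣ toℕ i - toℕ p ∣ _ _ _ ⟩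
  (∣ toℕ i - toℕ p ∣ + ∣ toℕ j - toℕ q ∣) + (∣ toℕ p - toℕ k ∣ + ∣ toℕ q - toℕ l ∣) ∎
  where open ≤-Reasoning

manhattan-step : ∀ a b c → manhattan a b ≡ 1 → manhattan a c ≤ suc (manhattan b c)
manhattan-step a b c ab≡1 = ≤-trans (manhattan-triangle a b c) (≤-reflexive (cong (_+ manhattan b c) ab≡1))

origin attachment : Cell
origin     = # 0 , # 0
attachment = # 1 , # 2

IsAttach⇒≡attachment : ∀ {i j} → IsAttach i j → (i , j) ≡ attachment
IsAttach⇒≡attachment (i≡1 , j≡2) = cong₂ _,_ (toℕ-injective i≡1) (toℕ-injective j≡2)

hubDist : Cell → ℕ
hubDist a = suc (manhattan a attachment)

module _ {t : ℕ} where

  at : Fin t → Cell → HV t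
  at c (i , j) = cp c i j

  at-injective : ∀ {c a b} → at c a ≡ at c b → a ≡ b
  at-injective {a = _ , _} {b = _ , _} refl = refl

  distH : HV t → HV t → ℕ
  distH hub        hub         = 0
  distH hub        (cp c k l)  = hubDist (k , l)
  distH (cp c i j) hub         = hubDist (i , j)
  distH (cp c i j) (cp c′ k l) =
    if does (c Fin.≟ c′) then manhattan (i , j) (k , l) else hubDist (i , j) + hubDist (k , l)

  distH-inCopy : ∀ c a b → distH (at c a) (at c b) ≡ manhattan a b
  distH-inCopy c (i , j) (k , l) rewrite dec-true (c Fin.≟ c) refl = refl

  distH-acrossCopies : ∀ {c c′} a b → c ≢ c′ → distH (at c a) (at c′ b) ≡ hubDist a + hubDist b
  distH-acrossCopies {c} {c′} (i , j) (k , l) c≢c′ rewrite dec-false (c Fin.≟ c′) c≢c′ = refl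

  distH-refl : ∀ v → distH v v ≡ 0
  distH-refl hub        = refl
  distH-refl (cp c i j) = trans (distH-inCopy c (i , j) (i , j)) (manhattan-self (i , j))

  distH-edge : ∀ {u w} v → HE t u w → distH u v ≤ suc (distH w v)
  distH-edge {hub} {cp c i j} hub        e = z≤n
  distH-edge {hub} {cp c i j} (cp c′ k l) e with IsAttach⇒≡attachment e | c Fin.≟ c′
  ... | refl | yes _ = s≤s (≤-reflexive (manhattan-sym (k , l) attachment))
  ... | refl | no _  = m≤n⇒m≤1+n (n≤1+n _)
  distH-edge {cp c i j} {hub} hub        e with IsAttach⇒≡attachment e
  ... | refl = ≤-refl
  distH-edge {cp c i j} {hub} (cp c′ k l) e with IsAttach⇒≡attachment e | c Fin.≟ c′
  ... | refl | yes _ = ≤-trans (≤-reflexive (manhattan-sym attachment (k , l))) (m≤n⇒m≤1+n (n≤1+n _))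
  ... | refl | no _  = ≤-refl
  distH-edge {cp c i j} {cp .c i′ j′} hub         (refl , step) =
    s≤s (manhattan-step (i , j) (i′ , j′) attachment step)
  distH-edge {cp c i j} {cp .c i′ j′} (cp c″ k l) (refl , step) with c Fin.≟ c″
  ... | yes _ = manhattan-step (i , j) (i′ , j′) (k , l) step
  ... | no _  = +-monoˡ-≤ (hubDist (k , l)) (s≤s (manhattan-step (i , j) (i′ , j′) attachment step))

  distH-≤-len : ∀ {u v} (p : Walk (HE t) u v) → distH u v ≤ len (HE t) p
  distH-≤-len = len-≥ distH distH-refl distH-edge

  isShortest-distH : ∀ {u v} (p : Walk (HE t) u v) → len (HE t) p ≡ distH u v → IsShortest (HE t) p
  isShortest-distH = isShortest distH distH-refl distH-edge

  HE-sym : ∀ {u v} → HE t u v → HE t v u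
  HE-sym {hub}      {cp _ _ _}  e              = e
  HE-sym {cp _ _ _} {hub}       e              = e
  HE-sym {cp c i j} {cp _ k l}  (refl , step) = refl , trans (manhattan-sym (k , l) (i , j)) step

  visits-hub : ∀ {c c′ i j k l} → c ≢ c′ → (p : Walk (HE t) (cp c i j) (cp c′ k l)) → hub ∈ verts (HE t) p
  visits-hub c≢c′ nil                                = contradiction refl c≢c′
  visits-hub c≢c′ (cons {w = hub} _ p)               = there (head-∈-verts p)
  visits-hub c≢c′ (cons {w = cp _ _ _} (refl , _) p) = there (visits-hub c≢c′ p)

  ¬visible-acrossCopies : ∀ {X c c′} → X hub ≡ true → c ≢ c′ →
                          ∀ a b → ¬ Visible (HE t) X (at c a) (at c′ b)
  ¬visible-acrossCopies hub∈X c≢c′ (i , j) (k , l) (p , _ , avoids)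
    with All.lookup avoids (visits-hub c≢c′ p) hub∈X
  ... | inj₁ ()
  ... | inj₂ ()

mutual
  clearPathᵇ : (Cell → Bool) → ℕ → Cell → Cell → Bool
  clearPathᵇ S zero    a b = ⌊ a ≟ᶜ b ⌋
  clearPathᵇ S (suc n) a b = any (clearStepᵇ S n a b) cells

  clearStepᵇ : (Cell → Bool) → ℕ → Cell → Cell → Cell → Bool
  clearStepᵇ S n a b p =
    (manhattan a p ≡ᵇ 1) ∧ (manhattan p b ≡ᵇ n) ∧ (⌊ p ≟ᶜ b ⌋ ∨ not (S p)) ∧ clearPathᵇ S n p b

seesHubᵇ : (Cell → Bool) → Cell → Bool
seesHubᵇ S a =
  ⌊ a ≟ᶜ attachment ⌋ ∨ (not (S attachment) ∧ clearPathᵇ S (manhattan a attachment) a attachment)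

-- A requirement is a pair of vertices of one copy: two cells, or a cell and x. When x ∉ X and
-- X meets the copy in S, metᵇ S r says that the pair is X-visible (OnCopy), and a demand says
-- whether a dual resp. outer set has to make the pair visible.
data Requirement : Set where
  between : Cell → Cell → Requirement
  toHub   : Cell → Requirement

metᵇ : (Cell → Bool) → Requirement → Bool
metᵇ S (between a b) = clearPathᵇ S (manhattan a b) a b
metᵇ S (toHub a)     = seesHubᵇ S a

infixr 4 _⇒ᵇ_
_⇒ᵇ_ : Bool → Bool → Bool
true  ⇒ᵇ b = b
false ⇒ᵇ _ = true

⇒ᵇ-intro : ∀ {a b} → (T a → T b) → T (a ⇒ᵇ b)
⇒ᵇ-intro {true}  a⇒b = a⇒b _
⇒ᵇ-intro {false} _   = _

⇒ᵇ-elim : ∀ {a b} → T (a ⇒ᵇ b) → T a → T b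
⇒ᵇ-elim {true} a⇒b _ = a⇒b

dualDemandᵇ : (Cell → Bool) → Requirement → Bool
dualDemandᵇ S (between a b) = ⌊ S a Bool.≟ S b ⌋
dualDemandᵇ S (toHub a)     = not (S a)

outerDemandᵇ : (Cell → Bool) → Requirement → Bool
outerDemandᵇ S (between a _) = S a
outerDemandᵇ S (toHub a)     = S a

Respectsᵇ : ((Cell → Bool) → Requirement → Bool) → (Cell → Bool) → Requirement → Bool
Respectsᵇ demand S r = demand S r ⇒ᵇ metᵇ S r

open Equivalence

module ClearPath {t : ℕ} (X : HV t → Bool) (c : Fin t) (S : Cell → Bool)
                 (X≗S : ∀ a → X (at c a) ≡ S a) where

  gridEdge : ∀ a b → manhattan a b ≡ 1 → HE t (at c a) (at c b)
  gridEdge (i , j) (k , l) step = refl , step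

  clearPath-sound : ∀ n a b → T (clearPathᵇ S n a b) →
                    Σ (Walk (HE t) (at c a) (at c b)) λ p → len (HE t) p ≡ n × InteriorAvoids X p
  clearPath-sound zero a b a≡b with toWitness a≡b
  ... | refl = nil , refl , (λ _ → inj₁ refl) ∷ []
  clearPath-sound (suc n) a b path with satisfied (any⁻ (clearStepᵇ S n a b) cells path)
  ... | p , step with to (T-∧ {manhattan a p ≡ᵇ 1}) step
  ... | a~p , step₁ with to (T-∧ {manhattan p b ≡ᵇ n}) step₁
  ... | _ , step₂ with to (T-∧ {⌊ p ≟ᶜ b ⌋ ∨ not (S p)}) step₂
  ... | p-free , rest with clearPath-sound n p b rest
  ... | w , w-len , w-avoids =
    cons (gridEdge a p (≡ᵇ⇒≡ _ _ a~p)) w , cong suc w-len ,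
    InteriorAvoids-cons (gridEdge a p (≡ᵇ⇒≡ _ _ a~p)) w p∈X⇒p≡b w-avoids
    where
    p∈X⇒p≡b : X (at c p) ≡ true → at c p ≡ at c b
    p∈X⇒p≡b p∈X with to (T-∨ {⌊ p ≟ᶜ b ⌋}) p-free
    ... | inj₁ p≡b = cong (at c) (toWitness p≡b)
    ... | inj₂ p∉S = contradiction (trans (sym p∈X) (trans (X≗S p) (to T-not-≡ p∉S))) λ ()

  FarOrTarget : ℕ → Cell → HV t → Set
  FarOrTarget n b x = X x ≡ true → x ≡ at c b ⊎ n ≤ distH x (at c b)

  -- The start may lie in X: the distance bound of FarOrTarget covers it, and unlike
  -- "x is an endpoint" that bound survives passing to the tail of the walk.
  clearPath-complete : ∀ n a b (p : Walk (HE t) (at c a) (at c b)) → len (HE t) p ≡ n →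
                       manhattan a b ≡ n → All (FarOrTarget n b) (verts (HE t) p) → T (clearPathᵇ S n a b)
  clearPath-complete zero    (i , j) (k , l) nil        _     _     _ = fromWitness refl
  clearPath-complete (suc n) (i , j) (k , l) (cons {w = hub} e w) p-len ab≡n _
    with IsAttach⇒≡attachment e
  ... | refl = contradiction (distH-≤-len w) λ hubDist≤n → <-irrefl refl (begin-strict
    n                                   <⟨ n<1+n n ⟩
    suc n                               ≡⟨ sym ab≡n ⟩
    manhattan attachment (k , l)        ≡⟨ manhattan-sym attachment (k , l) ⟩
    manhattan (k , l) attachment        <⟨ hubDist≤n ⟩
    len (HE t) w                        ≡⟨ suc-injective p-len ⟩
    n                                   ∎)
    where open ≤-Reasoning
  clearPath-complete (suc n) a@(i , j) b@(k , l) (cons {w = cp _ i′ j′} (refl , step) w) p-len ab≡n (_ ∷ far) =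
    any⁺ (clearStepᵇ S n a b) (lose (∈-cells p) (from T-∧ (≡⇒≡ᵇ _ _ step ,
      from T-∧ (≡⇒≡ᵇ _ _ pb≡n , from T-∧ (p-free , rest)))))
    where
    p = (i′ , j′)
    w-len : len (HE t) w ≡ n
    w-len = suc-injective p-len
    pb≡n : manhattan p b ≡ n
    pb≡n = ≤-antisym
      (≤-trans (≤-reflexive (sym (distH-inCopy c p b))) (≤-trans (distH-≤-len w) (≤-reflexive w-len)))
      (≤-pred (≤-trans (≤-reflexive (sym ab≡n)) (manhattan-step a p b step)))
    p-free : T (⌊ p ≟ᶜ b ⌋ ∨ not (S p))
    p-free with S p in p∈?S
    ... | false = from (T-∨ {⌊ p ≟ᶜ b ⌋}) (inj₂ _)
    ... | true with All.lookup far (head-∈-verts w) (trans (X≗S p) p∈?S)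
    ...   | inj₁ refl = from (T-∨ {⌊ p ≟ᶜ p ⌋}) (inj₁ (fromWitness refl))
    ...   | inj₂ n<d  = contradiction (≤-trans n<d (≤-reflexive (trans (distH-inCopy c p b) pb≡n))) (<-irrefl refl)
    weaken : ∀ {x} → FarOrTarget (suc n) b x → FarOrTarget n b x
    weaken far-x x∈X with far-x x∈X
    ... | inj₁ x≡b = inj₁ x≡b
    ... | inj₂ n<d = inj₂ (≤-trans (n≤1+n n) n<d)
    rest : T (clearPathᵇ S n p b)
    rest = clearPath-complete n p b w w-len pb≡n (All.map weaken far)

everyCell : (P : Cell → Bool) → T (all P cells) → ∀ a → T (P a)
everyCell P all-P a = All.lookup (all⁺ P cells all-P) (∈-cells a)

everyPair : (P : Cell → Cell → Bool) → T (all (λ a → all (P a) cells) cells) → ∀ a b → T (P a b)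
everyPair P all-P a = everyCell (P a) (everyCell (λ a → all (P a) cells) all-P a)

grid-geodesics : ∀ a b → T (clearPathᵇ (λ _ → false) (manhattan a b) a b)
grid-geodesics = everyPair (λ a b → clearPathᵇ (λ _ → false) (manhattan a b) a b) _

module _ {t : ℕ} where

  geodesic : ∀ c a b → Σ (Walk (HE t) (at c a) (at c b)) λ p → len (HE t) p ≡ manhattan a b
  geodesic c a b
    with ClearPath.clearPath-sound (λ _ → false) c (λ _ → false) (λ _ → refl) _ a b (grid-geodesics a b)
  ... | p , p-len , _ = p , p-len

  hubEdge : ∀ c → HE t (at c attachment) hub
  hubEdge c = refl , refl

  viaAttachment : ∀ {c a} → Walk (HE t) (at c a) (at c attachment) → Walk (HE t) (at c a) hub
  viaAttachment {c} p = p ++ʷ cons (hubEdge c) nil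

  len-viaAttachment : ∀ {c a} (p : Walk (HE t) (at c a) (at c attachment)) →
                      len (HE t) p ≡ manhattan a attachment → len (HE t) (viaAttachment p) ≡ hubDist a
  len-viaAttachment {a = a} p p-len =
    trans (len-++ʷ p _) (trans (cong (_+ 1) p-len) (+-comm (manhattan a attachment) 1))

  hubRoute : ∀ c a → Σ (Walk (HE t) (at c a) hub) λ p → len (HE t) p ≡ hubDist a
  hubRoute c a with geodesic c a attachment
  ... | p , p-len = viaAttachment p , len-viaAttachment p p-len

module OnCopy {t : ℕ} (X : HV t → Bool) (c : Fin t) (S : Cell → Bool)
              (X≗S : ∀ a → X (at c a) ≡ S a) where

  open ClearPath X c S X≗S

  visible⇒clearPath : ∀ a b → Visible (HE t) X (at c a) (at c b) → T (clearPathᵇ S (manhattan a b) a b)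
  visible⇒clearPath a b (p , shortest , avoids) = clearPath-complete _ a b p p-len refl (All.map far avoids)
    where
    p-len : len (HE t) p ≡ manhattan a b
    p-len = ≤-antisym
      (≤-trans (shortest (proj₁ (geodesic c a b))) (≤-reflexive (proj₂ (geodesic c a b))))
      (≤-trans (≤-reflexive (sym (distH-inCopy c a b))) (distH-≤-len p))
    far : ∀ {x} → (X x ≡ true → x ≡ at c a ⊎ x ≡ at c b) → FarOrTarget (manhattan a b) b x
    far h x∈X with h x∈X
    ... | inj₁ refl = inj₂ (≤-reflexive (sym (distH-inCopy c a b)))
    ... | inj₂ x≡b  = inj₁ x≡b

  approach⇒seesHub : X hub ≡ false → ∀ a c′ (q : Walk (HE t) (at c a) (at c′ attachment)) →
                     suc (len (HE t) q) ≤ hubDist a →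
                     All (λ x → X x ≡ true → x ≡ at c a ⊎ x ≡ hub) (verts (HE t) q) → T (seesHubᵇ S a)
  approach⇒seesHub hub∉X a c′ q short avoids with c Fin.≟ c′
  ... | no c≢c′ = contradiction (≤-trans (distH-≤-len q) (≤-pred short)) (λ d≤m → <-irrefl refl (begin-strict
      manhattan a attachment                      <⟨ m≤m+n (hubDist a) 1 ⟩
      hubDist a + hubDist attachment              ≡⟨ sym (distH-acrossCopies a attachment c≢c′) ⟩
      distH (at c a) (at c′ attachment)           ≤⟨ d≤m ⟩
      manhattan a attachment                      ∎))
    where open ≤-Reasoning
  ... | yes refl with S attachment in attachment∈?S
  ... | false = from (T-∨ {⌊ a ≟ᶜ attachment ⌋})
                  (inj₂ (clearPath-complete _ a attachment q q-len refl (All.map far avoids)))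
    where
    q-len : len (HE t) q ≡ manhattan a attachment
    q-len = ≤-antisym (≤-pred short) (≤-trans (≤-reflexive (sym (distH-inCopy c a attachment))) (distH-≤-len q))
    far : ∀ {x} → (X x ≡ true → x ≡ at c a ⊎ x ≡ hub) → FarOrTarget (manhattan a attachment) attachment x
    far h x∈X with h x∈X
    ... | inj₁ refl = inj₂ (≤-reflexive (sym (distH-inCopy c a attachment)))
    ... | inj₂ refl = contradiction (trans (sym x∈X) hub∉X) λ ()
  ... | true with All-verts-last q avoids (trans (X≗S attachment) attachment∈?S)
  ...   | inj₁ attachment≡a =
    from (T-∨ {⌊ a ≟ᶜ attachment ⌋}) (inj₁ (fromWitness (sym (at-injective attachment≡a))))
  ...   | inj₂ ()

  visible⇒seesHub : X hub ≡ false → ∀ a → Visible (HE t) X (at c a) hub → T (seesHubᵇ S a)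
  visible⇒seesHub hub∉X a@(i , j) (cons e p , shortest , avoids) with unsnoc e p
  ... | hub         , _ , () , _
  ... | cp c′ i′ j′ , q , e′ , p≡q+e′ with IsAttach⇒≡attachment e′
  ... | refl = approach⇒seesHub hub∉X a c′ q short
                 (All-verts-++ʷ⁻ˡ q _ (subst (λ r → All _ (verts (HE t) r)) p≡q+e′ avoids))
    where
    short : suc (len (HE t) q) ≤ hubDist a
    short = begin
      suc (len (HE t) q)                 ≡⟨ +-comm 1 (len (HE t) q) ⟩
      len (HE t) q + 1                   ≡⟨ sym (len-++ʷ q (cons e′ nil)) ⟩
      len (HE t) (q ++ʷ cons e′ nil)     ≡⟨ cong (len (HE t)) (sym p≡q+e′) ⟩
      len (HE t) (cons e p)              ≤⟨ shortest (proj₁ (hubRoute c a)) ⟩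
      len (HE t) (proj₁ (hubRoute c a))  ≡⟨ proj₂ (hubRoute c a) ⟩
      hubDist a                          ∎
      where open ≤-Reasoning

  clearPath⇒visible : ∀ a b → T (clearPathᵇ S (manhattan a b) a b) → Visible (HE t) X (at c a) (at c b)
  clearPath⇒visible a b path with clearPath-sound _ a b path
  ... | p , p-len , avoids = p , isShortest-distH p (trans p-len (sym (distH-inCopy c a b))) , avoids

  seesHub⇒route : X hub ≡ false → ∀ a → T (seesHubᵇ S a) →
                  Σ (Walk (HE t) (at c a) hub) λ p → len (HE t) p ≡ hubDist a × InteriorAvoids X p
  seesHub⇒route hub∉X a sees with to (T-∨ {⌊ a ≟ᶜ attachment ⌋}) sees
  ... | inj₁ a≡attachment with toWitness a≡attachment
  ... | refl = cons (hubEdge c) nil , refl , (λ _ → inj₁ refl) ∷ (λ _ → inj₂ refl) ∷ []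
  seesHub⇒route hub∉X a sees | inj₂ clear with to (T-∧ {not (S attachment)}) clear
  ... | attachment∉S , path with clearPath-sound _ a attachment path
  ... | p , p-len , avoids =
    viaAttachment p , len-viaAttachment p p-len ,
    InteriorAvoids-++ʷ p (cons (hubEdge c) nil) (trans (X≗S attachment) (to T-not-≡ attachment∉S))
      avoids ((λ _ → inj₁ refl) ∷ (λ _ → inj₂ refl) ∷ [])

  seesHub⇒visible : X hub ≡ false → ∀ a → T (seesHubᵇ S a) → Visible (HE t) X (at c a) hub
  seesHub⇒visible hub∉X a@(i , j) sees with seesHub⇒route hub∉X a sees
  ... | p , p-len , avoids = p , isShortest-distH p p-len , avoids

  source target : Requirement → HV t
  source (between a _) = at c a
  source (toHub a)     = at c a
  target (between _ b) = at c b
  target (toHub _)     = hub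

  visible⇒met : X hub ≡ false → ∀ r → Visible (HE t) X (source r) (target r) → T (metᵇ S r)
  visible⇒met _     (between a b) = visible⇒clearPath a b
  visible⇒met hub∉X (toHub a)     = visible⇒seesHub hub∉X a

  dualDemand⇒sameStatus : X hub ≡ false → ∀ r → T (dualDemandᵇ S r) → X (source r) ≡ X (target r)
  dualDemand⇒sameStatus _     (between a b) Sa≡Sb = trans (X≗S a) (trans (toWitness Sa≡Sb) (sym (X≗S b)))
  dualDemand⇒sameStatus hub∉X (toHub a)     a∉S   = trans (X≗S a) (trans (to T-not-≡ a∉S) (sym hub∉X))

  outerDemand⇒source∈X : ∀ r → T (outerDemandᵇ S r) → X (source r) ≡ true
  outerDemand⇒source∈X (between a _) a∈S = trans (X≗S a) (to T-≡ a∈S)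
  outerDemand⇒source∈X (toHub a)     a∈S = trans (X≗S a) (to T-≡ a∈S)

  dual⇒respects : X hub ≡ false → IsDualMV (HE t) X → ∀ r → T (Respectsᵇ dualDemandᵇ S r)
  dual⇒respects hub∉X dual r = ⇒ᵇ-intro λ demanded →
    visible⇒met hub∉X r (visible-sameStatus dual (dualDemand⇒sameStatus hub∉X r demanded))

  outer⇒respects : X hub ≡ false → IsOuterMV (HE t) X → ∀ r → T (Respectsᵇ outerDemandᵇ S r)
  outer⇒respects hub∉X outer r = ⇒ᵇ-intro λ demanded →
    visible⇒met hub∉X r (visible-fromMember outer (target r) (outerDemand⇒source∈X r demanded))

lookupGrid : Subset 12 → Cell → Bool
lookupGrid p (i , j) = lookup p (combine i j)

gridPattern : (Cell → Bool) → Subset 12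
gridPattern S = tabulate (λ k → S (remQuot 3 k))

lookupGrid-gridPattern : ∀ S a → lookupGrid (gridPattern S) a ≡ S a
lookupGrid-gridPattern S (i , j) =
  trans (lookup∘tabulate (λ k → S (remQuot 3 k)) (combine i j)) (cong S (remQuot-combine i j))

-- The implicit argument is discharged by evaluating anySubset?, i.e. by checking all 2ⁿ subsets.
subset-bound : ∀ {n} (P : Subset n → Bool) k → {False (anySubset? λ p → T? (P p) ×-dec k <? ∣ p ∣)} →
               ∀ p → T (P p) → ∣ p ∣ ≤ k
subset-bound P k {none} p Pp = ≮⇒≥ λ k<∣p∣ → toWitnessFalse none (p , Pp , k<∣p∣)

-- Found by computer search: any pattern respecting these few requirements is already small.
dualCertificate : List Requirement
dualCertificate =
  toHub (# 3 , # 0) ∷ toHub (# 0 , # 2) ∷ toHub (# 0 , # 0) ∷ toHub (# 1 , # 0) ∷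
  between (# 0 , # 2) (# 3 , # 0) ∷ between (# 0 , # 0) (# 3 , # 0) ∷ between (# 3 , # 0) (# 3 , # 2) ∷
  between (# 0 , # 0) (# 0 , # 2) ∷ between (# 2 , # 2) (# 3 , # 0) ∷ between (# 0 , # 0) (# 3 , # 2) ∷
  between (# 1 , # 0) (# 2 , # 1) ∷ between (# 0 , # 2) (# 3 , # 2) ∷ between (# 0 , # 0) (# 2 , # 1) ∷ []

outerCertificate : List Requirement
outerCertificate =
  toHub (# 3 , # 0) ∷
  between (# 0 , # 0) (# 3 , # 0) ∷ between (# 0 , # 1) (# 3 , # 1) ∷ between (# 0 , # 2) (# 3 , # 2) ∷
  between (# 3 , # 2) (# 0 , # 0) ∷ between (# 3 , # 1) (# 0 , # 1) ∷ between (# 1 , # 0) (# 3 , # 0) ∷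
  between (# 1 , # 2) (# 3 , # 2) ∷ between (# 3 , # 0) (# 3 , # 2) ∷ between (# 1 , # 1) (# 3 , # 1) ∷
  between (# 0 , # 0) (# 0 , # 2) ∷ between (# 0 , # 1) (# 3 , # 0) ∷ between (# 3 , # 0) (# 0 , # 0) ∷
  between (# 0 , # 0) (# 1 , # 2) ∷ between (# 0 , # 0) (# 3 , # 1) ∷ []

dualCertificate-bound : ∀ p → T (all (Respectsᵇ dualDemandᵇ (lookupGrid p)) dualCertificate) → ∣ p ∣ ≤ 5
dualCertificate-bound = subset-bound (λ p → all (Respectsᵇ dualDemandᵇ (lookupGrid p)) dualCertificate) 5

outerCertificate-bound : ∀ p → T (all (Respectsᵇ outerDemandᵇ (lookupGrid p)) outerCertificate) → ∣ p ∣ ≤ 4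
outerCertificate-bound = subset-bound (λ p → all (Respectsᵇ outerDemandᵇ (lookupGrid p)) outerCertificate) 4

sum-map-≤ : ∀ {A : Set} (f : A → ℕ) {k} xs → (∀ x → f x ≤ k) → sum (map f xs) ≤ length xs * k
sum-map-≤ f []       _   = z≤n
sum-map-≤ f (x ∷ xs) f≤k = +-mono-≤ (f≤k x) (sum-map-≤ f xs f≤k)

sum-map-≡ : ∀ {A : Set} (f : A → ℕ) {k} xs → (∀ x → f x ≡ k) → sum (map f xs) ≡ length xs * k
sum-map-≡ f []       _   = refl
sum-map-≡ f (x ∷ xs) f≡k = cong₂ _+_ (f≡k x) (sum-map-≡ f xs f≡k)

∣p∣≡sum : ∀ {n} (p : Subset n) → ∣ p ∣ ≡ Vec.sum (Vec.map (λ b → if b then 1 else 0) p)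
∣p∣≡sum []          = refl
∣p∣≡sum (true ∷ p)  = cong suc (∣p∣≡sum p)
∣p∣≡sum (false ∷ p) = ∣p∣≡sum p

sum-map-concatMap : ∀ {A B : Set} (f : B → ℕ) (g : A → List B) xs →
                    sum (map f (concatMap g xs)) ≡ sum (map (λ x → sum (map f (g x))) xs)
sum-map-concatMap f g []       = refl
sum-map-concatMap f g (x ∷ xs) = begin
  sum (map f (g x ++ concatMap g xs))                         ≡⟨ cong sum (map-++ f (g x) _) ⟩
  sum (map f (g x) ++ map f (concatMap g xs))                 ≡⟨ sum-++ (map f (g x)) _ ⟩
  sum (map f (g x)) + sum (map f (concatMap g xs))            ≡⟨ cong (sum (map f (g x)) +_) (sum-map-concatMap f g xs) ⟩
  sum (map f (g x)) + sum (map (λ x → sum (map f (g x))) xs)  ∎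
  where open ≡-Reasoning

module _ {t : ℕ} where

  copyPattern : (HV t → Bool) → Fin t → Subset 12
  copyPattern X c = gridPattern (λ a → X (at c a))

  copyCounts : (HV t → Bool) → ℕ
  copyCounts X = sum (map (λ c → ∣ copyPattern X c ∣) (allFin t))

  card-allHV : ∀ X → card (allHV t) X ≡ (if X hub then 1 else 0) + copyCounts X
  card-allHV X = cong ((if X hub then 1 else 0) +_) (trans
    (sum-map-concatMap _ _ (allFin t))
    (cong sum (map-cong (λ c → sym (∣p∣≡sum (copyPattern X c))) (allFin t))))

  copyCounts-≤ : ∀ X k → (∀ c → ∣ copyPattern X c ∣ ≤ k) → copyCounts X ≤ t * k
  copyCounts-≤ X k bound =
    subst (λ n → copyCounts X ≤ n * k) (length-tabulate {n = t} id) (sum-map-≤ _ (allFin t) bound)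

  module CopyOf (X : HV t → Bool) (c : Fin t) =
    OnCopy X c (lookupGrid (copyPattern X c)) (λ a → sym (lookupGrid-gridPattern (λ a → X (at c a)) a))

  dual-copyBound : ∀ X → X hub ≡ false → IsDualMV (HE t) X → ∀ c → ∣ copyPattern X c ∣ ≤ 5
  dual-copyBound X hub∉X dual c = dualCertificate-bound (copyPattern X c)
    (all⁻ _ (All.universal (CopyOf.dual⇒respects X c hub∉X dual) dualCertificate))

  outer-copyBound : ∀ X → X hub ≡ false → IsOuterMV (HE t) X → ∀ c → ∣ copyPattern X c ∣ ≤ 4
  outer-copyBound X hub∉X outer c = outerCertificate-bound (copyPattern X c)
    (all⁻ _ (All.universal (CopyOf.outer⇒respects X c hub∉X outer) outerCertificate))

  -- In a copy lying inside X, the only geodesic between the corners (1,1) and (1,3) passes through (1,2).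
  full⇒¬dual : ∀ X c → (∀ a → X (at c a) ≡ true) → ¬ IsDualMV (HE t) X
  full⇒¬dual X c full dual =
    OnCopy.visible⇒clearPath X c (λ _ → true) full (# 0 , # 0) (# 0 , # 2) (proj₁ dual _ _ (full _) (full _))

  hub∈X⇒differ : ∀ X → X hub ≡ true → IsDualMV (HE t) X →
                 ∀ {c c′} → c ≢ c′ → ∀ a b → X (at c a) ≢ X (at c′ b)
  hub∈X⇒differ X hub∈X dual c≢c′ a b same =
    ¬visible-acrossCopies hub∈X c≢c′ a b (visible-sameStatus dual same)

differ⇒oneAllTrue : ∀ {A : Set} (a₀ : A) (f g : A → Bool) → (∀ a b → f a ≢ g b) →
                    (∀ a → f a ≡ true) ⊎ (∀ b → g b ≡ true)
differ⇒oneAllTrue a₀ f g differ with f a₀ in fa₀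
... | true  = inj₁ λ a → trans (¬-not (differ a a₀)) (trans (sym (¬-not (differ a₀ a₀))) fa₀)
... | false = inj₂ λ b → trans (¬-not (differ a₀ b ∘ sym)) (cong not fa₀)

dual⇒hub∉X : ∀ {t} → 2 ≤ t → ∀ X → IsDualMV (HE t) X → X hub ≡ false
dual⇒hub∉X {suc zero} (s≤s ())
dual⇒hub∉X {suc (suc _)} _ X dual with X hub in hub∈?X
... | false = refl
... | true with differ⇒oneAllTrue origin (λ a → X (at (# 0) a)) (λ b → X (at (# 1) b))
                 (hub∈X⇒differ X hub∈?X dual λ ())
...   | inj₁ full₀ = contradiction dual (full⇒¬dual X (# 0) full₀)
...   | inj₂ full₁ = contradiction dual (full⇒¬dual X (# 1) full₁)

outer-hub∈X⇒copiesEmpty : ∀ {t} → 2 ≤ t → ∀ X → IsOuterMV (HE t) X → X hub ≡ true →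
                          ∀ c a → X (at c a) ≡ false
outer-hub∈X⇒copiesEmpty {suc zero} (s≤s ())
outer-hub∈X⇒copiesEmpty {suc (suc _)} _ X outer hub∈X c a with X (at c a) in a∈?X
... | false = refl
... | true  = contradiction (visible-fromMember outer (at c′ origin) a∈?X)
                (¬visible-acrossCopies hub∈X (punchInᵢ≢i c Fin.zero ∘ sym) a origin)
  where c′ = Fin.punchIn c Fin.zero

dual-card-≤ : ∀ {t} → 2 ≤ t → ∀ X → IsDualMV (HE t) X → card (allHV t) X ≤ 5 * t
dual-card-≤ {t} 2≤t X dual = begin
  card (allHV t) X                               ≡⟨ card-allHV X ⟩
  (if X hub then 1 else 0) + copyCounts X        ≡⟨ cong (λ b → (if b then 1 else 0) + copyCounts X) hub∉X ⟩
  copyCounts X                                   ≤⟨ copyCounts-≤ X 5 (dual-copyBound X hub∉X dual) ⟩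
  t * 5                                          ≡⟨ *-comm t 5 ⟩
  5 * t                                          ∎
  where
  open ≤-Reasoning
  hub∉X = dual⇒hub∉X 2≤t X dual

outer-card-≤ : ∀ {t} → 2 ≤ t → ∀ X → IsOuterMV (HE t) X → card (allHV t) X ≤ 4 * t
outer-card-≤ {t} 2≤t X outer = ≤-trans (≤-reflexive (card-allHV X)) (by-hub (X hub) refl)
  where
  open ≤-Reasoning
  by-hub : ∀ b → X hub ≡ b → (if b then 1 else 0) + copyCounts X ≤ 4 * t
  by-hub false hub∉X = begin
    copyCounts X  ≤⟨ copyCounts-≤ X 4 (outer-copyBound X hub∉X outer) ⟩
    t * 4         ≡⟨ *-comm t 4 ⟩
    4 * t         ∎
  by-hub true hub∈X = begin
    1 + copyCounts X  ≤⟨ +-monoʳ-≤ 1 (copyCounts-≤ X 0 empty) ⟩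
    1 + t * 0         ≡⟨ cong suc (*-zeroʳ t) ⟩
    1                 ≤⟨ ≤-trans (s≤s z≤n) (≤-trans 2≤t (m≤n*m t 4)) ⟩
    4 * t             ∎
    where
    empty : ∀ c → ∣ copyPattern X c ∣ ≤ 0
    empty c = ≤-reflexive (trans
      (cong ∣_∣ (tabulate-cong λ k → outer-hub∈X⇒copiesEmpty 2≤t X outer hub∈X c (remQuot 3 k)))
      (∣⊥∣≡0 12))

uniform : ∀ {t} → (Cell → Bool) → HV t → Bool
uniform S hub        = false
uniform S (cp _ i j) = S (i , j)

uniform-at : ∀ {t} S c a → uniform {t} S (at c a) ≡ S a
uniform-at S c (i , j) = refl

module Uniform {t : ℕ} (S : Cell → Bool) (seen : ∀ a → T (seesHubᵇ S a)) where

  private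
    module C (c : Fin t) = OnCopy (uniform S) c S (uniform-at S c)

  visible-toHub : ∀ c a → Visible (HE t) (uniform S) (at c a) hub
  visible-toHub c a = C.seesHub⇒visible c refl a (seen a)

  visible-fromHub : ∀ c a → Visible (HE t) (uniform S) hub (at c a)
  visible-fromHub c a = visible-sym HE-sym (visible-toHub c a)

  visible-cells : ∀ c c′ a b → T (clearPathᵇ S (manhattan a b) a b) →
                  Visible (HE t) (uniform S) (at c a) (at c′ b)
  visible-cells c c′ a b path with c Fin.≟ c′
  ... | yes refl = C.clearPath⇒visible c a b path
  ... | no c≢c′ with C.seesHub⇒route c refl a (seen a) | C.seesHub⇒route c′ refl b (seen b)
  ...   | p , p-len , p-avoids | q , q-len , q-avoids =
    route , isShortest-distH route route-len ,
    InteriorAvoids-++ʷ p (reverseʷ HE-sym q) refl p-avoids (InteriorAvoids-reverseʷ HE-sym q q-avoids)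
    where
    route = p ++ʷ reverseʷ HE-sym q
    route-len : len (HE t) route ≡ distH (at c a) (at c′ b)
    route-len = begin
      len (HE t) route                              ≡⟨ len-++ʷ p _ ⟩
      len (HE t) p + len (HE t) (reverseʷ HE-sym q) ≡⟨ cong₂ _+_ p-len (trans (len-reverseʷ HE-sym q) q-len) ⟩
      hubDist a + hubDist b                         ≡⟨ sym (distH-acrossCopies a b c≢c′) ⟩
      distH (at c a) (at c′ b)                      ∎
      where open ≡-Reasoning

member : List Cell → Cell → Bool
member bs a = any (λ b → ⌊ a ≟ᶜ b ⌋) bs

-- In 1-based coordinates: (1,1), (1,3), (2,1), (4,2), (4,3), resp. the four corners.
dualPattern outerPattern : Cell → Bool
dualPattern  = member ((# 0 , # 0) ∷ (# 0 , # 2) ∷ (# 1 , # 0) ∷ (# 3 , # 1) ∷ (# 3 , # 2) ∷ [])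
outerPattern = member ((# 0 , # 0) ∷ (# 0 , # 2) ∷ (# 3 , # 0) ∷ (# 3 , # 2) ∷ [])

module _ {t : ℕ} where

  private
    module D = Uniform {t} dualPattern (everyCell _ _)
    module O = Uniform {t} outerPattern (everyCell _ _)

  dualSet-isDual : IsDualMV (HE t) (uniform dualPattern)
  dualSet-isDual = both-in , both-out
    where
    X = uniform dualPattern
    sameStatus : ∀ c c′ a b → dualPattern a ≡ dualPattern b → Visible (HE t) X (at c a) (at c′ b)
    sameStatus c c′ a b same = D.visible-cells c c′ a b
      (⇒ᵇ-elim (everyPair (λ a b → Respectsᵇ dualDemandᵇ dualPattern (between a b)) _ a b) (fromWitness same))
    both-in : ∀ u v → X u ≡ true → X v ≡ true → Visible (HE t) X u v
    both-in (cp c i j) (cp c′ k l) a∈X b∈X = sameStatus c c′ (i , j) (k , l) (trans a∈X (sym b∈X))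
    both-out : ∀ u v → X u ≡ false → X v ≡ false → Visible (HE t) X u v
    both-out hub        hub         _   _   = nil , (λ _ → z≤n) , (λ ()) ∷ []
    both-out hub        (cp c k l)  _   _   = D.visible-fromHub c (k , l)
    both-out (cp c i j) hub         _   _   = D.visible-toHub c (i , j)
    both-out (cp c i j) (cp c′ k l) a∉X b∉X = sameStatus c c′ (i , j) (k , l) (trans a∉X (sym b∉X))

  outerSet-isOuter : IsOuterMV (HE t) (uniform outerPattern)
  outerSet-isOuter = (λ u v u∈X _ → fromMember u v u∈X) , (λ u v u∈X _ → fromMember u v u∈X)
    where
    fromMember : ∀ u v → uniform outerPattern u ≡ true → Visible (HE t) (uniform outerPattern) u v
    fromMember (cp c i j) hub         _   = O.visible-toHub c (i , j)
    fromMember (cp c i j) (cp c′ k l) a∈X = O.visible-cells c c′ (i , j) (k , l)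
      (⇒ᵇ-elim (everyPair (λ a b → Respectsᵇ outerDemandᵇ outerPattern (between a b)) _ (i , j) (k , l))
        (from (T-≡ {outerPattern (i , j)}) a∈X))

  card-uniform : ∀ S k → (∀ c → ∣ copyPattern (uniform S) c ∣ ≡ k) → card (allHV t) (uniform S) ≡ k * t
  card-uniform S k count = begin
    card (allHV t) (uniform {t} S)  ≡⟨ card-allHV (uniform {t} S) ⟩
    copyCounts (uniform {t} S)      ≡⟨ sum-map-≡ _ (allFin t) count ⟩
    length (allFin t) * k           ≡⟨ cong (_* k) (length-tabulate {n = t} id) ⟩
    t * k                           ≡⟨ *-comm t k ⟩
    k * t                           ∎
    where open ≡-Reasoning

proposition5p2 : (t : ℕ) → 2 ≤ t →
    IsMaxCard (allHV t) (IsDualMV (HE t)) (5 * t) ×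
    IsMaxCard (allHV t) (IsOuterMV (HE t)) (4 * t)
proposition5p2 t 2≤t =
  ((uniform dualPattern , dualSet-isDual , card-uniform {t} dualPattern 5 λ _ → refl) , dual-card-≤ 2≤t) ,
  ((uniform outerPattern , outerSet-isOuter , card-uniform {t} outerPattern 4 λ _ → refl) , outer-card-≤ 2≤t)
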